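{- Let $G$ be a $2$-connected outerplanar graph on at least five vertices and let $C$ be a cycle of length $4$ in $G$. If $a,b\in V(C)$ are distinct vertices, neither of which has a neighbour in $V(G)\setminus V(C)$, then $a$ and $b$ are consecutive on $C$.
   Context: A graph is $2$-connected if it has more than $2$ vertices and cannot be disconnected by removing fewer than $2$ vertices. -}

module Defs where

open import Level using (0ℓ)
open import Data.Nat using (ℕ; _≤_)
open import Data.Fin using (Fin; zero; suc; _<_)
open import Data.Product using (Σ; _×_; ∃)
open import Data.Sum using (_⊎_)
open import Data.Unit using (⊤)
open import Relation.Nullary using (¬_)
open import Relation.Binary.PropositionalEquality using (_≡_; _≢_)
open import Function.Definitions using (Injective)

record Graph (n : ℕ) : Set₁ where
  field
    Adj    : Fin n → Fin n → Set
    sym    : ∀ {u v} → Adj u v → Adj v u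
    irrefl : ∀ {v} → ¬ Adj v v
open Graph public

data Reach {n : ℕ} (G : Graph n) (S : Fin n → Set) : Fin n → Fin n → Set where
  here : ∀ {x} → S x → Reach G S x x
  step : ∀ {x y z} → S x → Adj G x y → Reach G S y z → Reach G S x z

ConnectedOn : {n : ℕ} → Graph n → (Fin n → Set) → Set
ConnectedOn G S = ∀ x y → S x → S y → Reach G S x y

-- 2-connected: more than 2 vertices, and removing fewer than 2 vertices
-- (i.e. none, or a single vertex v) leaves a connected graph.
TwoConnected : {n : ℕ} → Graph n → Set
TwoConnected {n} G =
  (3 ≤ n) × ConnectedOn G (λ _ → ⊤) × (∀ v → ConnectedOn G (λ x → x ≢ v))

-- Outerplanar: the vertices can be placed in a cyclic order (on a circle,
-- positions given by the bijection pos) so that, drawing edges as chords,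
-- no two edges cross.
NoCrossing : {n : ℕ} → Graph n → (Fin n → Fin n) → Set
NoCrossing G pos = ∀ u v x y → Adj G u v → Adj G x y →
  ¬ (pos u < pos x × pos x < pos v × pos v < pos y)

Outerplanar : {n : ℕ} → Graph n → Set
Outerplanar {n} G =
  Σ (Fin n → Fin n) λ pos → Injective _≡_ _≡_ pos × NoCrossing G pos

next4 : Fin 4 → Fin 4
next4 zero = suc zero
next4 (suc zero) = suc (suc zero)
next4 (suc (suc zero)) = suc (suc (suc zero))
next4 (suc (suc (suc zero))) = zero

IsCycle4 : {n : ℕ} → Graph n → (Fin 4 → Fin n) → Set
IsCycle4 G c = Injective _≡_ _≡_ c × (∀ i → Adj G (c i) (c (next4 i)))

OnCycle : {n : ℕ} → (Fin 4 → Fin n) → Fin n → Set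
OnCycle c v = ∃ λ i → c i ≡ v

Consecutive : {n : ℕ} → (Fin 4 → Fin n) → Fin n → Fin n → Set
Consecutive c a b =
  ∃ λ i → (c i ≡ a × c (next4 i) ≡ b) ⊎ (c i ≡ b × c (next4 i) ≡ a)

-- Read the outerplanar embedding as positions on a line. As edges do not cross, an edge disjoint
-- from an edge st joins two vertices on the same side of st (both or neither strictly between s
-- and t). Suppose two opposite vertices of C have no neighbour off C and take x off C (n ≥ 5).
-- Every edge st of C has one of them, s, as an endpoint. If x were not on the side of st holding
-- the rest of C, a walk from x to C in G − t would have to change sides, which it can only do by
-- entering s from a neighbour of s; but those lie on C, on the far side. So x is on the inner side
-- of all four edges of C, which is impossible: modulo 2 the betweenness indicators of x telescope
-- to 0 around C, while those of the vertices of C add up to 1.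
module Submission where

open import Defs
open import Data.Nat using (ℕ; _≤_)
open import Data.Fin using (Fin)
open import Relation.Nullary using (¬_)
open import Relation.Binary.PropositionalEquality using (_≢_)

open import Data.Bool using (Bool; true; false; not; _xor_)
open import Data.Bool.Properties using (xor-assoc; xor-comm; xor-same) renaming (_≟_ to _≟ᴮ_)
open import Data.Empty using (⊥)
open import Data.Fin using (toℕ)
open import Data.Fin.Patterns using (0F; 1F; 2F; 3F)
open import Data.Fin.Properties using (toℕ-injective; any?; all?; ¬∀⟶∃¬; pigeonhole; <⇒≢)
  renaming (_≟_ to _≟ᶠ_)
open import Data.Nat using (_<_)
open import Data.Nat.Properties using (_<?_; <-cmp; <-trans; <⇒≯)
open import Data.Product using (_×_; _,_; ∃; proj₁; proj₂; map₂; curry)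
open import Data.Sum using (_⊎_; inj₁; inj₂; [_,_]′)
open import Function using (_∘_)
open import Function.Definitions using (Injective)
open import Relation.Binary.Definitions using (tri<; tri≈; tri>)
open import Relation.Binary.PropositionalEquality
  using (_≡_; refl; trans; cong; cong₂; ≢-sym; module ≡-Reasoning)
import Relation.Binary.PropositionalEquality as ≡
open import Relation.Nullary using (Dec; does; yes; no; contradiction)
open import Relation.Nullary.Decidable using (dec-true; dec-false; decidable-stable)

xor-telescope : ∀ x y z → (x xor y) xor (y xor z) ≡ x xor z
xor-telescope x y z = begin
  (x xor y) xor (y xor z)  ≡⟨ xor-assoc x y (y xor z) ⟩
  x xor (y xor (y xor z))  ≡⟨ cong (x xor_) (≡.sym (xor-assoc y y z)) ⟩
  x xor ((y xor y) xor z)  ≡⟨ cong (λ b → x xor (b xor z)) (xor-same y) ⟩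
  x xor z                  ∎
  where open ≡-Reasoning

xor-triangle : ∀ p q r {p′ q′ r′} → p′ ≡ not p → q′ ≡ not q → r′ ≡ not r →
  (p xor q) xor (r xor p′) xor (q′ xor r′) ≡ true
xor-triangle false false false refl refl refl = refl
xor-triangle false false true  refl refl refl = refl
xor-triangle false true  false refl refl refl = refl
xor-triangle false true  true  refl refl refl = refl
xor-triangle true  false false refl refl refl = refl
xor-triangle true  false true  refl refl refl = refl
xor-triangle true  true  false refl refl refl = refl
xor-triangle true  true  true  refl refl refl = refl

-- Exactly one of a, b lies below z: for z ∉ {a, b}, z lies strictly between a and b.
between : ℕ → ℕ → ℕ → Bool
between a b z = does (a <? z) xor does (b <? z)

module _ {a b z : ℕ} where

  between-below : z < a → z < b → between a b z ≡ false
  between-below z<a z<b = cong₂ _xor_ (dec-false (a <? z) (<⇒≯ z<a)) (dec-false (b <? z) (<⇒≯ z<b))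

  between-inside : a < z → z < b → between a b z ≡ true
  between-inside a<z z<b = cong₂ _xor_ (dec-true (a <? z) a<z) (dec-false (b <? z) (<⇒≯ z<b))

  between-above : a < z → b < z → between a b z ≡ false
  between-above a<z b<z = cong₂ _xor_ (dec-true (a <? z) a<z) (dec-true (b <? z) b<z)

between-sym : ∀ a b z → between a b z ≡ between b a z
between-sym a b z = xor-comm (does (a <? z)) (does (b <? z))

between-trans : ∀ a b c z → between a b z xor between b c z ≡ between a c z
between-trans a b c z = xor-telescope (does (a <? z)) (does (b <? z)) (does (c <? z))

<?-flip : ∀ {a b} → a ≢ b → does (a <? b) ≡ not (does (b <? a))
<?-flip {a} {b} a≢b with <-cmp a b
... | tri< a<b _ _ = trans (dec-true (a <? b) a<b) (cong not (≡.sym (dec-false (b <? a) (<⇒≯ a<b))))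
... | tri≈ _ a≡b _ = contradiction a≡b a≢b
... | tri> _ _ b<a = trans (dec-false (a <? b) (<⇒≯ b<a)) (cong not (≡.sym (dec-true (b <? a) b<a)))

-- Of the six comparisons, exactly one per pair {a, b}, {b, c}, {c, a} holds.
between-triangle : ∀ {a b c} → a ≢ b → b ≢ c → c ≢ a →
  between a b c xor between b c a xor between c a b ≡ true
between-triangle {a} {b} {c} a≢b b≢c c≢a =
  xor-triangle (does (a <? c)) (does (b <? c)) (does (b <? a))
    (<?-flip c≢a) (<?-flip (≢-sym b≢c)) (<?-flip a≢b)

crossing-chords : ∀ {a b z w} → a < b → z < w → z ≢ a → z ≢ b → w ≢ a → w ≢ b →
  between a b z ≢ between a b w →
  (z < a × a < w × w < b) ⊎ (a < z × z < b × b < w)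
crossing-chords {a} {b} {z} {w} a<b z<w z≢a z≢b w≢a w≢b differ with <-cmp z a
... | tri≈ _ z≡a _ = contradiction z≡a z≢a
... | tri< z<a _ _ with <-cmp w a
...   | tri≈ _ w≡a _ = contradiction w≡a w≢a
...   | tri< w<a _ _ = contradiction
  (trans (between-below z<a (<-trans z<a a<b)) (≡.sym (between-below w<a (<-trans w<a a<b)))) differ
...   | tri> _ _ a<w with <-cmp w b
...     | tri< w<b _ _ = inj₁ (z<a , a<w , w<b)
...     | tri≈ _ w≡b _ = contradiction w≡b w≢b
...     | tri> _ _ b<w = contradiction
  (trans (between-below z<a (<-trans z<a a<b)) (≡.sym (between-above a<w b<w))) differ
crossing-chords {a} {b} {z} {w} a<b z<w z≢a z≢b w≢a w≢b differ | tri> _ _ a<z with <-cmp z b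
...   | tri≈ _ z≡b _ = contradiction z≡b z≢b
...   | tri> _ _ b<z = contradiction
  (trans (between-above a<z b<z) (≡.sym (between-above (<-trans a<z z<w) (<-trans b<z z<w)))) differ
...   | tri< z<b _ _ with <-cmp w b
...     | tri> _ _ b<w = inj₂ (a<z , z<b , b<w)
...     | tri≈ _ w≡b _ = contradiction w≡b w≢b
...     | tri< w<b _ _ = contradiction
  (trans (between-inside a<z z<b) (≡.sym (between-inside (<-trans a<z z<w) w<b))) differ

¬inside-quadrilateral : ∀ {a₀ a₁ a₂ a₃ x} → a₀ ≢ a₁ → a₁ ≢ a₂ → a₂ ≢ a₀ →
  between a₀ a₁ x ≡ between a₀ a₁ a₂ → between a₁ a₂ x ≡ between a₁ a₂ a₀ →
  between a₂ a₃ x ≡ between a₂ a₃ a₁ → between a₃ a₀ x ≡ between a₃ a₀ a₁ → ⊥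
¬inside-quadrilateral {a₀} {a₁} {a₂} {a₃} {x} a₀≢a₁ a₁≢a₂ a₂≢a₀ e₀₁ e₁₂ e₂₃ e₃₀ =
  contradiction parity λ ()
  where
  open ≡-Reasoning
  -- The indicators of x telescope to false, those of the vertices add up to true.
  parity : false ≡ true
  parity = begin
    false
      ≡⟨ ≡.sym (xor-same (does (a₀ <? x))) ⟩
    between a₀ a₀ x
      ≡⟨ ≡.sym (between-trans a₀ a₁ a₀ x) ⟩
    between a₀ a₁ x xor between a₁ a₀ x
      ≡⟨ cong (between a₀ a₁ x xor_) (≡.sym (between-trans a₁ a₂ a₀ x)) ⟩
    between a₀ a₁ x xor between a₁ a₂ x xor between a₂ a₀ x
      ≡⟨ cong (λ t → between a₀ a₁ x xor between a₁ a₂ x xor t) (≡.sym (between-trans a₂ a₃ a₀ x)) ⟩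
    between a₀ a₁ x xor between a₁ a₂ x xor between a₂ a₃ x xor between a₃ a₀ x
      ≡⟨ cong₂ _xor_ e₀₁ (cong₂ _xor_ e₁₂ (cong₂ _xor_ e₂₃ e₃₀)) ⟩
    between a₀ a₁ a₂ xor between a₁ a₂ a₀ xor between a₂ a₃ a₁ xor between a₃ a₀ a₁
      ≡⟨ cong (λ t → between a₀ a₁ a₂ xor between a₁ a₂ a₀ xor t) (between-trans a₂ a₃ a₀ a₁) ⟩
    between a₀ a₁ a₂ xor between a₁ a₂ a₀ xor between a₂ a₀ a₁
      ≡⟨ between-triangle a₀≢a₁ a₁≢a₂ a₂≢a₀ ⟩
    true ∎

Reach-start : ∀ {n} {G : Graph n} {S : Fin n → Set} {x y} → Reach G S x y → S x
Reach-start (here Sx) = Sx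
Reach-start (step Sx _ _) = Sx

NeighboursOnCycle : ∀ {n} → Graph n → (Fin 4 → Fin n) → Fin n → Set
NeighboursOnCycle G c v = ∀ w → Adj G v w → OnCycle c w

prev4 : Fin 4 → Fin 4
prev4 0F = 3F
prev4 1F = 0F
prev4 2F = 1F
prev4 3F = 2F

next4-prev4 : ∀ i → next4 (prev4 i) ≡ i
next4-prev4 0F = refl
next4-prev4 1F = refl
next4-prev4 2F = refl
next4-prev4 3F = refl

prev4-next4 : ∀ i → prev4 (next4 i) ≡ i
prev4-next4 0F = refl
prev4-next4 1F = refl
prev4-next4 2F = refl
prev4-next4 3F = refl

next4-injective : Injective _≡_ _≡_ next4
next4-injective {i} {j} e = trans (≡.sym (prev4-next4 i)) (trans (cong prev4 e) (prev4-next4 j))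

adjacent-or-opposite : ∀ i k → i ≢ k → k ≡ next4 i ⊎ i ≡ next4 k ⊎ k ≡ next4 (next4 i)
adjacent-or-opposite 0F 0F i≢k = contradiction refl i≢k
adjacent-or-opposite 0F 1F _ = inj₁ refl
adjacent-or-opposite 0F 2F _ = inj₂ (inj₂ refl)
adjacent-or-opposite 0F 3F _ = inj₂ (inj₁ refl)
adjacent-or-opposite 1F 0F _ = inj₂ (inj₁ refl)
adjacent-or-opposite 1F 1F i≢k = contradiction refl i≢k
adjacent-or-opposite 1F 2F _ = inj₁ refl
adjacent-or-opposite 1F 3F _ = inj₂ (inj₂ refl)
adjacent-or-opposite 2F 0F _ = inj₂ (inj₂ refl)
adjacent-or-opposite 2F 1F _ = inj₂ (inj₁ refl)
adjacent-or-opposite 2F 2F i≢k = contradiction refl i≢k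
adjacent-or-opposite 2F 3F _ = inj₁ refl
adjacent-or-opposite 3F 0F _ = inj₁ refl
adjacent-or-opposite 3F 1F _ = inj₂ (inj₂ refl)
adjacent-or-opposite 3F 2F _ = inj₂ (inj₁ refl)
adjacent-or-opposite 3F 3F i≢k = contradiction refl i≢k

module _ {n} (G : Graph n) {c : Fin 4 → Fin n} where

  IsCycle4-rotate : IsCycle4 G c → IsCycle4 G (c ∘ next4)
  IsCycle4-rotate (c-injective , adjacent) = (λ e → next4-injective (c-injective e)) , adjacent ∘ next4

  NeighboursOnCycle-rotate : ∀ {v} → NeighboursOnCycle G c v → NeighboursOnCycle G (c ∘ next4) v
  NeighboursOnCycle-rotate closed w vw with i , ci≡w ← closed w vw =
    prev4 i , trans (cong c (next4-prev4 i)) ci≡w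

point-outside-image : ∀ {m n} → m < n → (f : Fin m → Fin n) → ∃ λ y → ∀ i → f i ≢ y
point-outside-image {m} {n} m<n f = witness (all? in-image?)
  where
  in-image? : ∀ y → Dec (∃ λ i → f i ≡ y)
  in-image? y = any? λ i → f i ≟ᶠ y
  witness : Dec (∀ y → ∃ λ i → f i ≡ y) → ∃ λ y → ∀ i → f i ≢ y
  witness (no ¬all) = map₂ curry (¬∀⟶∃¬ n _ in-image? ¬all)
  witness (yes all) with y₁ , y₂ , y₁<y₂ , same ← pigeonhole m<n (proj₁ ∘ all) =
    contradiction (trans (≡.sym (proj₂ (all y₁))) (trans (cong f same) (proj₂ (all y₂)))) (<⇒≢ y₁<y₂)

module Drawing {n} (G : Graph n) (P : Fin n → ℕ) (P-injective : Injective _≡_ _≡_ P)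
  (planar : ∀ u v x y → Adj G u v → Adj G x y → ¬ (P u < P x × P x < P v × P v < P y)) where

  SameSide : Fin n → Fin n → Fin n → Fin n → Set
  SameSide s t y r = between (P s) (P t) (P y) ≡ between (P s) (P t) (P r)

  SameSide-swap : ∀ {s t y r} → SameSide s t y r → SameSide t s y r
  SameSide-swap {s} {t} {y} {r} same =
    trans (between-sym (P t) (P s) (P y)) (trans same (between-sym (P s) (P t) (P r)))

  Adj⇒≢ : ∀ {u v} → Adj G u v → u ≢ v
  Adj⇒≢ uv refl = irrefl G uv

  P-≢ : ∀ {u v} → u ≢ v → P u ≢ P v
  P-≢ u≢v = u≢v ∘ P-injective

  ordered-edge-keeps-side : ∀ {u v z w} → Adj G u v → Adj G z w → P u < P v → P z < P w →
    z ≢ u → z ≢ v → w ≢ u → w ≢ v → SameSide u v z w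
  ordered-edge-keeps-side {u} {v} {z} {w} uv zw u<v z<w z≢u z≢v w≢u w≢v =
    decidable-stable (_ ≟ᴮ _) λ differ →
      [ planar z w u v zw uv , planar u v z w uv zw ]′
        (crossing-chords u<v z<w (P-≢ z≢u) (P-≢ z≢v) (P-≢ w≢u) (P-≢ w≢v) differ)

  edge-keeps-side : ∀ {u v z w} → Adj G u v → Adj G z w →
    z ≢ u → z ≢ v → w ≢ u → w ≢ v → SameSide u v z w
  edge-keeps-side {u} {v} {z} {w} uv zw z≢u z≢v w≢u w≢v with <-cmp (P u) (P v) | <-cmp (P z) (P w)
  ... | tri≈ _ Pu≡Pv _ | _ = contradiction Pu≡Pv (P-≢ (Adj⇒≢ uv))
  ... | _ | tri≈ _ Pz≡Pw _ = contradiction Pz≡Pw (P-≢ (Adj⇒≢ zw))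
  ... | tri< u<v _ _ | tri< z<w _ _ =
    ordered-edge-keeps-side uv zw u<v z<w z≢u z≢v w≢u w≢v
  ... | tri< u<v _ _ | tri> _ _ w<z =
    ≡.sym (ordered-edge-keeps-side uv (sym G zw) u<v w<z w≢u w≢v z≢u z≢v)
  ... | tri> _ _ v<u | tri< z<w _ _ =
    SameSide-swap (ordered-edge-keeps-side (sym G uv) zw v<u z<w z≢v z≢u w≢v w≢u)
  ... | tri> _ _ v<u | tri> _ _ w<z =
    SameSide-swap (≡.sym (ordered-edge-keeps-side (sym G uv) (sym G zw) v<u w<z w≢v w≢u z≢v z≢u))

  walk-keeps-side : ∀ {s t x z w} → Adj G s t →
    (∀ y → Adj G s y → y ≢ t → ¬ SameSide s t y x) →
    Reach G (_≢ t) z w → z ≢ s → SameSide s t z x → SameSide s t w x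
  walk-keeps-side st away (here _) _ z~x = z~x
  walk-keeps-side {s} {t} {x} st away (step {z} {y} z≢t zy walk) z≢s z~x =
    walk-keeps-side st away walk y≢s (trans (≡.sym z~y) z~x)
    where
    y≢t : y ≢ t
    y≢t = Reach-start walk
    y≢s : y ≢ s
    y≢s refl = away z (sym G zy) z≢t z~x
    z~y : SameSide s t z y
    z~y = edge-keeps-side st zy z≢s z≢t y≢s y≢t

  neighbours-on-side⇒all-on-side : ∀ {s t r x} → ConnectedOn G (_≢ t) → Adj G s t → r ≢ t →
    (∀ y → Adj G s y → y ≢ t → SameSide s t y r) → x ≢ s → x ≢ t → SameSide s t x r
  neighbours-on-side⇒all-on-side {s} {t} {r} {x} connected st r≢t near x≢s x≢t =
    decidable-stable (_ ≟ᴮ _) λ x≁r →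
      x≁r (≡.sym (walk-keeps-side st (λ y sy y≢t y~x → x≁r (trans (≡.sym y~x) (near y sy y≢t)))
                    (connected x r x≢t r≢t) x≢s refl))

  module _ (connected : ∀ t → ConnectedOn G (_≢ t)) where

    cycle-edge-side : ∀ {c x} → IsCycle4 G c →
      NeighboursOnCycle G c (c 0F) ⊎ NeighboursOnCycle G c (c 1F) → (∀ i → c i ≢ x) →
      SameSide (c 0F) (c 1F) x (c 2F) × SameSide (c 0F) (c 1F) x (c 3F)
    cycle-edge-side {c} {x} (c-injective , adjacent) closed x∉C = x~c₂ closed , trans (x~c₂ closed) c₂~c₃
      where
      distinct : ∀ {i j} → i ≢ j → c i ≢ c j
      distinct i≢j = i≢j ∘ c-injective

      c₂~c₃ : SameSide (c 0F) (c 1F) (c 2F) (c 3F)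
      c₂~c₃ = edge-keeps-side (adjacent 0F) (adjacent 2F)
        (distinct λ ()) (distinct λ ()) (distinct λ ()) (distinct λ ())

      others~c₂ : ∀ {y} → OnCycle c y → y ≢ c 0F → y ≢ c 1F → SameSide (c 0F) (c 1F) y (c 2F)
      others~c₂ (0F , refl) y≢c₀ _ = contradiction refl y≢c₀
      others~c₂ (1F , refl) _ y≢c₁ = contradiction refl y≢c₁
      others~c₂ (2F , refl) _ _ = refl
      others~c₂ (3F , refl) _ _ = ≡.sym c₂~c₃

      x~c₂ : NeighboursOnCycle G c (c 0F) ⊎ NeighboursOnCycle G c (c 1F) →
        SameSide (c 0F) (c 1F) x (c 2F)
      x~c₂ (inj₁ closed₀) =
        neighbours-on-side⇒all-on-side (connected (c 1F)) (adjacent 0F) (distinct λ ())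
          (λ y c₀y y≢c₁ → others~c₂ (closed₀ y c₀y) (Adj⇒≢ (sym G c₀y)) y≢c₁)
          (≢-sym (x∉C 0F)) (≢-sym (x∉C 1F))
      x~c₂ (inj₂ closed₁) = SameSide-swap
        (neighbours-on-side⇒all-on-side (connected (c 0F)) (sym G (adjacent 0F)) (distinct λ ())
          (λ y c₁y y≢c₀ → SameSide-swap (others~c₂ (closed₁ y c₁y) y≢c₀ (Adj⇒≢ (sym G c₁y))))
          (≢-sym (x∉C 1F)) (≢-sym (x∉C 0F)))

    not-both-closed₀₂ : ∀ {c x} → IsCycle4 G c →
      NeighboursOnCycle G c (c 0F) → NeighboursOnCycle G c (c 2F) → (∀ i → c i ≢ x) → ⊥
    -- Rotating C brings each of its four edges to the position (c 0F, c 1F).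
    not-both-closed₀₂ {c} {x} cycle closed₀ closed₂ x∉C =
      ¬inside-quadrilateral {x = P x} (distinct λ ()) (distinct λ ()) (distinct λ ())
        (proj₁ (cycle-edge-side cycle (inj₁ closed₀) x∉C))
        (proj₂ (cycle-edge-side cycle₁ (inj₂ (rotate closed₂)) (x∉C ∘ next4)))
        (proj₂ (cycle-edge-side cycle₂ (inj₁ (rotate (rotate closed₂))) (x∉C ∘ next4 ∘ next4)))
        (proj₁ (cycle-edge-side cycle₃ (inj₂ (rotate (rotate (rotate closed₀)))) (x∉C ∘ next4 ∘ next4 ∘ next4)))
      where
      rotate : ∀ {c′ v} → NeighboursOnCycle G c′ v → NeighboursOnCycle G (c′ ∘ next4) v
      rotate = NeighboursOnCycle-rotate G
      cycle₁ : IsCycle4 G (c ∘ next4)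
      cycle₁ = IsCycle4-rotate G cycle
      cycle₂ : IsCycle4 G (c ∘ next4 ∘ next4)
      cycle₂ = IsCycle4-rotate G cycle₁
      cycle₃ : IsCycle4 G (c ∘ next4 ∘ next4 ∘ next4)
      cycle₃ = IsCycle4-rotate G cycle₂
      distinct : ∀ {i j} → i ≢ j → P (c i) ≢ P (c j)
      distinct i≢j = P-≢ (i≢j ∘ proj₁ cycle)

    opposite-not-both-closed : ∀ {c x} → IsCycle4 G c → ∀ i →
      NeighboursOnCycle G c (c i) → NeighboursOnCycle G c (c (next4 (next4 i))) → (∀ j → c j ≢ x) → ⊥
    opposite-not-both-closed cycle 0F closed₀ closed₂ = not-both-closed₀₂ cycle closed₀ closed₂
    opposite-not-both-closed cycle 1F closed₁ closed₃ x∉C = not-both-closed₀₂ (IsCycle4-rotate G cycle)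
      (NeighboursOnCycle-rotate G closed₁) (NeighboursOnCycle-rotate G closed₃) (x∉C ∘ next4)
    opposite-not-both-closed cycle 2F closed₂ closed₀ = not-both-closed₀₂ cycle closed₀ closed₂
    opposite-not-both-closed cycle 3F closed₃ closed₁ x∉C = not-both-closed₀₂ (IsCycle4-rotate G cycle)
      (NeighboursOnCycle-rotate G closed₁) (NeighboursOnCycle-rotate G closed₃) (x∉C ∘ next4)

lemma4 : (n : ℕ) (G : Graph n) → TwoConnected G → Outerplanar G → 5 ≤ n →
    (c : Fin 4 → Fin n) → IsCycle4 G c →
    (a b : Fin n) → OnCycle c a → OnCycle c b → a ≢ b →
    (∀ w → Adj G a w → OnCycle c w) →
    (∀ w → Adj G b w → OnCycle c w) →
    Consecutive c a b
lemma4 n G (_ , _ , connected) (pos , pos-injective , planar) 5≤n c cycle _ _ (i , refl) (k , refl) a≢b a-closed b-closed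
  with adjacent-or-opposite i k (a≢b ∘ cong c)
... | inj₁ refl = i , inj₁ (refl , refl)
... | inj₂ (inj₁ refl) = k , inj₂ (refl , refl)
... | inj₂ (inj₂ refl) with x , x∉C ← point-outside-image 5≤n c =
  contradiction x∉C (opposite-not-both-closed connected cycle i a-closed b-closed)
  where open Drawing G (toℕ ∘ pos) (pos-injective ∘ toℕ-injective) planar
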